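{- Let $\mathbf{Q}$ be an irreducible QB-algebra. Then the quotient $\mathbf{Q}/\chi$ is isomorphic to the two-element Boolean algebra $\mathbf{2}$.
   Context: A quasi-lattice is an algebra $\langle L;\vee,\wedge\rangle$ such that for all $x,y,z$: $\vee,\wedge$ are commutative and associative; $x\vee(x\wedge y)=x\vee x$ and $x\wedge(x\vee y)=x\wedge x$; $x\vee(y\vee y)=x\vee y$ and $x\wedge(y\wedge y)=x\wedge y$; $x\vee x=x\wedge x$; distributive if both distributive laws hold. A QB-algebra is an algebra $\langle Q;\vee,\wedge,{}^{*},0,1\rangle$ of type $\langle 2,2,1,0,0\rangle$ such that $\langle Q;\vee,\wedge\rangle$ is a distributive quasi-lattice and for all $x$: $x\vee 1=1$, $x\wedge 0=0$, $x\vee x^{*}=1$, $x\wedge x^{*}=0$, $(x\wedge x)^{*}=x^{*}\vee x^{*}$, $x^{**}=x$. A QB-algebra is flat if $1=0$. An element $x$ is regular if $x\vee x=x$; $\mathscr{R}(Q)$ is the set of regular elements. A non-flat QB-algebra is irreducible if $\mathscr{R}(Q)=\{0,1\}$. The relation $\chi=\{\langle x,y\rangle: x\vee x=y\vee y\}$ is a congruence on $\mathbf{Q}$, and $\mathbf{Q}/\chi$ denotes the quotient algebra. -}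

module Defs where

open import Level using (Level; suc; _⊔_)
open import Data.Bool using (Bool; true; false; _∨_; _∧_; not)
open import Data.Product using (_×_; ∃-syntax)
open import Data.Sum using (_⊎_)
open import Relation.Binary.PropositionalEquality using (_≡_)
open import Relation.Nullary using (¬_)

record QBAlgebra (c : Level) : Set (suc c) where
  infixr 6 _⊔q_
  infixr 7 _⊓q_
  field
    Carrier : Set c
    _⊔q_ _⊓q_ : Carrier → Carrier → Carrier
    _*  : Carrier → Carrier
    𝟎 𝟏 : Carrier
    ⊔-comm  : ∀ x y → x ⊔q y ≡ y ⊔q x
    ⊓-comm  : ∀ x y → x ⊓q y ≡ y ⊓q x
    ⊔-assoc : ∀ x y z → (x ⊔q y) ⊔q z ≡ x ⊔q (y ⊔q z)
    ⊓-assoc : ∀ x y z → (x ⊓q y) ⊓q z ≡ x ⊓q (y ⊓q z)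
    ⊔-absorb : ∀ x y → x ⊔q (x ⊓q y) ≡ x ⊔q x
    ⊓-absorb : ∀ x y → x ⊓q (x ⊔q y) ≡ x ⊓q x
    ⊔-idem-r : ∀ x y → x ⊔q (y ⊔q y) ≡ x ⊔q y
    ⊓-idem-r : ∀ x y → x ⊓q (y ⊓q y) ≡ x ⊓q y
    ⊔x≡⊓x   : ∀ x → x ⊔q x ≡ x ⊓q x
    ⊓-distrib-⊔ : ∀ x y z → x ⊓q (y ⊔q z) ≡ (x ⊓q y) ⊔q (x ⊓q z)
    ⊔-distrib-⊓ : ∀ x y z → x ⊔q (y ⊓q z) ≡ (x ⊔q y) ⊓q (x ⊔q z)
    ⊔-𝟏 : ∀ x → x ⊔q 𝟏 ≡ 𝟏
    ⊓-𝟎 : ∀ x → x ⊓q 𝟎 ≡ 𝟎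
    ⊔-* : ∀ x → x ⊔q (x *) ≡ 𝟏
    ⊓-* : ∀ x → x ⊓q (x *) ≡ 𝟎
    *-⊓ : ∀ x → (x ⊓q x) * ≡ (x *) ⊔q (x *)
    *-* : ∀ x → (x *) * ≡ x

module _ {c : Level} (Q : QBAlgebra c) where
  open QBAlgebra Q

  Flat : Set c
  Flat = 𝟏 ≡ 𝟎

  Regular : Carrier → Set c
  Regular x = x ⊔q x ≡ x

  Irreducible : Set c
  Irreducible = (¬ Flat) × (∀ x → (Regular x → (x ≡ 𝟎 ⊎ x ≡ 𝟏)) × ((x ≡ 𝟎 ⊎ x ≡ 𝟏) → Regular x))

  χ : Carrier → Carrier → Set c
  χ x y = x ⊔q x ≡ y ⊔q y

  -- Since Agda has no quotient types, an isomorphism Q/χ → 2 is given by a map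
  -- f : Q → 2 that is constant on χ-classes and separates them (so it induces a
  -- well-defined injective map on Q/χ), is surjective, and is a homomorphism.
  record Quotientχ≅2 : Set c where
    field
      f : Carrier → Bool
      f-respects : ∀ x y → χ x y → f x ≡ f y
      f-reflects : ∀ x y → f x ≡ f y → χ x y
      f-surj     : ∀ b → ∃[ x ] f x ≡ b
      f-⊔ : ∀ x y → f (x ⊔q y) ≡ f x ∨ f y
      f-⊓ : ∀ x y → f (x ⊓q y) ≡ f x ∧ f y
      f-* : ∀ x → f (x *) ≡ not (f x)
      f-𝟎 : f 𝟎 ≡ false
      f-𝟏 : f 𝟏 ≡ true

-- In any QB-algebra the map ρ x = x ∨ x is a homomorphism onto the regular
-- elements, and ρ x = ρ y is exactly χ.  If Q is irreducible, the regular
-- elements are just 0 ≠ 1, which form a copy ι(2) of the two-element Boolean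
-- algebra; so ρ = ι ∘ f for a unique f : Q → 2, and f inherits from ρ that it
-- is a homomorphism whose kernel is χ.
module Submission where

open import Defs
open import Level using (Level)
open import Algebra.Bundles using (CommutativeSemigroup)
open import Algebra.Core using (Op₂)
open import Algebra.Definitions using (Commutative; Associative)
import Algebra.Properties.CommutativeSemigroup as CommutativeSemigroupProperties
open import Data.Bool using (Bool; true; false; _∨_; _∧_; not)
open import Data.Product using (∃-syntax; _,_; proj₁; proj₂)
open import Data.Sum using (inj₁; inj₂)
open import Relation.Binary.PropositionalEquality
open import Relation.Binary.PropositionalEquality.Algebra using (isMagma)
open import Relation.Nullary using (¬_; contradiction)

interchange : ∀ {a} {A : Set a} (_∙_ : Op₂ A) →
              Commutative _≡_ _∙_ → Associative _≡_ _∙_ →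
              ∀ w x y z → (w ∙ x) ∙ (y ∙ z) ≡ (w ∙ y) ∙ (x ∙ z)
interchange _∙_ comm assoc = CommutativeSemigroupProperties.interchange semigroup
  where
  semigroup : CommutativeSemigroup _ _
  semigroup = record
    { isCommutativeSemigroup = record
      { isSemigroup = record { isMagma = isMagma _∙_ ; assoc = assoc }
      ; comm = comm
      }
    }

module QBProperties {c : Level} (Q : QBAlgebra c) where
  open QBAlgebra Q
  open ≡-Reasoning

  ρ : Carrier → Carrier
  ρ x = x ⊔q x

  ρ-regular : ∀ x → Regular Q (ρ x)
  ρ-regular x = begin
    ρ x ⊔q (x ⊔q x)  ≡⟨ ⊔-idem-r (ρ x) x ⟩
    ρ x ⊔q x         ≡⟨ ⊔-comm (ρ x) x ⟩
    x ⊔q (x ⊔q x)    ≡⟨ ⊔-idem-r x x ⟩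
    ρ x              ∎

  ρ-⊔ : ∀ x y → ρ (x ⊔q y) ≡ ρ x ⊔q ρ y
  ρ-⊔ x y = interchange _⊔q_ ⊔-comm ⊔-assoc x y x y

  ρ-⊓ : ∀ x y → ρ (x ⊓q y) ≡ ρ x ⊓q ρ y
  ρ-⊓ x y = begin
    ρ (x ⊓q y)               ≡⟨ ⊔x≡⊓x (x ⊓q y) ⟩
    (x ⊓q y) ⊓q (x ⊓q y)     ≡⟨ interchange _⊓q_ ⊓-comm ⊓-assoc x y x y ⟩
    (x ⊓q x) ⊓q (y ⊓q y)     ≡⟨ sym (cong₂ _⊓q_ (⊔x≡⊓x x) (⊔x≡⊓x y)) ⟩
    ρ x ⊓q ρ y               ∎

  ρ-* : ∀ x → ρ (x *) ≡ ρ x *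
  ρ-* x = begin
    x * ⊔q x *   ≡⟨ *-⊓ x ⟨
    (x ⊓q x) *   ≡⟨ cong _* (⊔x≡⊓x x) ⟨
    ρ x *        ∎

  ρ-𝟎 : ρ 𝟎 ≡ 𝟎
  ρ-𝟎 = trans (⊔x≡⊓x 𝟎) (⊓-𝟎 𝟎)

  ρ-𝟏 : ρ 𝟏 ≡ 𝟏
  ρ-𝟏 = ⊔-𝟏 𝟏

  ⊔-𝟎 : ∀ x → x ⊔q 𝟎 ≡ ρ x
  ⊔-𝟎 x = trans (cong (x ⊔q_) (sym (⊓-𝟎 x))) (⊔-absorb x 𝟎)

  ⊓-𝟏 : ∀ x → x ⊓q 𝟏 ≡ x ⊓q x
  ⊓-𝟏 x = trans (cong (x ⊓q_) (sym (⊔-𝟏 x))) (⊓-absorb x 𝟏)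

  𝟎*≡𝟏 : 𝟎 * ≡ 𝟏
  𝟎*≡𝟏 = begin
    𝟎 *            ≡⟨ cong _* ρ-𝟎 ⟨
    ρ 𝟎 *          ≡⟨ ρ-* 𝟎 ⟨
    ρ (𝟎 *)        ≡⟨ ⊔-𝟎 (𝟎 *) ⟨
    𝟎 * ⊔q 𝟎       ≡⟨ ⊔-comm (𝟎 *) 𝟎 ⟩
    𝟎 ⊔q 𝟎 *       ≡⟨ ⊔-* 𝟎 ⟩
    𝟏              ∎

  𝟏*≡𝟎 : 𝟏 * ≡ 𝟎
  𝟏*≡𝟎 = begin
    𝟏 *            ≡⟨ cong _* ρ-𝟏 ⟨
    ρ 𝟏 *          ≡⟨ ρ-* 𝟏 ⟨
    ρ (𝟏 *)        ≡⟨ ⊔x≡⊓x (𝟏 *) ⟩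
    𝟏 * ⊓q 𝟏 *     ≡⟨ ⊓-𝟏 (𝟏 *) ⟨
    𝟏 * ⊓q 𝟏       ≡⟨ ⊓-comm (𝟏 *) 𝟏 ⟩
    𝟏 ⊓q 𝟏 *       ≡⟨ ⊓-* 𝟏 ⟩
    𝟎              ∎

  ι : Bool → Carrier
  ι false = 𝟎
  ι true  = 𝟏

  ι-injective : ¬ Flat Q → ∀ {a b} → ι a ≡ ι b → a ≡ b
  ι-injective _  {false} {false} _ = refl
  ι-injective nf {false} {true}  e = contradiction (sym e) nf
  ι-injective nf {true}  {false} e = contradiction e nf
  ι-injective _  {true}  {true}  _ = refl

  ρ-ι : ∀ b → ρ (ι b) ≡ ι b
  ρ-ι false = ρ-𝟎
  ρ-ι true  = ρ-𝟏

  ι-∨ : ∀ a b → ι (a ∨ b) ≡ ι a ⊔q ι b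
  ι-∨ false false = sym ρ-𝟎
  ι-∨ false true  = sym (⊔-𝟏 𝟎)
  ι-∨ true  false = sym (trans (⊔-comm 𝟏 𝟎) (⊔-𝟏 𝟎))
  ι-∨ true  true  = sym ρ-𝟏

  ι-∧ : ∀ a b → ι (a ∧ b) ≡ ι a ⊓q ι b
  ι-∧ false false = sym (⊓-𝟎 𝟎)
  ι-∧ false true  = sym (trans (⊓-comm 𝟎 𝟏) (⊓-𝟎 𝟏))
  ι-∧ true  false = sym (⊓-𝟎 𝟏)
  ι-∧ true  true  = sym (trans (sym (⊔x≡⊓x 𝟏)) ρ-𝟏)

  ι-not : ∀ b → ι (not b) ≡ ι b *
  ι-not false = sym 𝟎*≡𝟏
  ι-not true  = sym 𝟏*≡𝟎

module IrreducibleQuotient {c : Level} (Q : QBAlgebra c) (irr : Irreducible Q) where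
  open QBAlgebra Q
  open QBProperties Q
  open ≡-Reasoning

  nonFlat : ¬ Flat Q
  nonFlat = proj₁ irr

  classify : ∀ x → ∃[ b ] ρ x ≡ ι b
  classify x with proj₁ (proj₂ irr (ρ x)) (ρ-regular x)
  ... | inj₁ ρx≡𝟎 = false , ρx≡𝟎
  ... | inj₂ ρx≡𝟏 = true  , ρx≡𝟏

  f : Carrier → Bool
  f x = proj₁ (classify x)

  ρ≡ι∘f : ∀ x → ρ x ≡ ι (f x)
  ρ≡ι∘f x = proj₂ (classify x)

  f-unique : ∀ {x b} → ρ x ≡ ι b → f x ≡ b
  f-unique {x} ρx≡ιb = ι-injective nonFlat (trans (sym (ρ≡ι∘f x)) ρx≡ιb)

  f∘ι : ∀ b → f (ι b) ≡ b
  f∘ι b = f-unique (ρ-ι b)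

  f-respects-χ : ∀ x y → χ Q x y → f x ≡ f y
  f-respects-χ x y ρx≡ρy = f-unique (trans ρx≡ρy (ρ≡ι∘f y))

  f-reflects-χ : ∀ x y → f x ≡ f y → χ Q x y
  f-reflects-χ x y fx≡fy = trans (ρ≡ι∘f x) (trans (cong ι fx≡fy) (sym (ρ≡ι∘f y)))

  f-⊔ : ∀ x y → f (x ⊔q y) ≡ f x ∨ f y
  f-⊔ x y = f-unique (begin
    ρ (x ⊔q y)           ≡⟨ ρ-⊔ x y ⟩
    ρ x ⊔q ρ y           ≡⟨ cong₂ _⊔q_ (ρ≡ι∘f x) (ρ≡ι∘f y) ⟩
    ι (f x) ⊔q ι (f y)   ≡⟨ ι-∨ (f x) (f y) ⟨
    ι (f x ∨ f y)        ∎)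

  f-⊓ : ∀ x y → f (x ⊓q y) ≡ f x ∧ f y
  f-⊓ x y = f-unique (begin
    ρ (x ⊓q y)           ≡⟨ ρ-⊓ x y ⟩
    ρ x ⊓q ρ y           ≡⟨ cong₂ _⊓q_ (ρ≡ι∘f x) (ρ≡ι∘f y) ⟩
    ι (f x) ⊓q ι (f y)   ≡⟨ ι-∧ (f x) (f y) ⟨
    ι (f x ∧ f y)        ∎)

  f-* : ∀ x → f (x *) ≡ not (f x)
  f-* x = f-unique (begin
    ρ (x *)              ≡⟨ ρ-* x ⟩
    ρ x *                ≡⟨ cong _* (ρ≡ι∘f x) ⟩
    ι (f x) *            ≡⟨ ι-not (f x) ⟨
    ι (not (f x))        ∎)

corollary3p13 : ∀ {c : Level} (Q : QBAlgebra c) → Irreducible Q → Quotientχ≅2 Q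
corollary3p13 Q irr = record
  { f          = f
  ; f-respects = f-respects-χ
  ; f-reflects = f-reflects-χ
  ; f-surj     = λ b → ι b , f∘ι b
  ; f-⊔        = f-⊔
  ; f-⊓        = f-⊓
  ; f-*        = f-*
  ; f-𝟎        = f∘ι false
  ; f-𝟏        = f∘ι true
  }
  where
  open QBProperties Q using (ι)
  open IrreducibleQuotient Q irr
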